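{- Let $S$ be a set and $\to\subseteq S\times S$ a binary relation. Let $P,Q,f\subseteq S\times S$, $F\subseteq(S\times S)\times(S\times S)$ and $c_0,c_1:S\to\mathbb{N}$. Suppose $\mathrm{Ensures2}_{\to}(P,Q,F,c_0,c_1)$ holds and that for all $s_0,s_1,s_0',s_1'\in S$, $((s_0,s_1),(s_0',s_1'))\in F$ implies $\big((s_0,s_1)\in f\iff(s_0',s_1')\in f\big)$. Then $\mathrm{Ensures2}_{\to}(P\cap f,Q\cap f,F,c_0,c_1)$ holds.
   Context: For $n\in\mathbb{N}$, $\to^n$ denotes the $n$-fold composition of $\to$, with $\to^0$ the identity relation on $S$. For $n\in\mathbb{N}$ and $Q\subseteq S$, $\mathrm{EvN}_{\to}(n,Q)=\{s\in S\mid (\forall s'.\ s\to^n s'\Rightarrow s'\in Q)\wedge(\forall s'\,\forall l<n.\ s\to^l s'\Rightarrow\exists s''.\ s'\to s'')\}$. For $P,Q\subseteq S\times S$, $F\subseteq(S\times S)\times(S\times S)$ and $c_0,c_1:S\to\mathbb{N}$, $\mathrm{Ensures2}_{\to}(P,Q,F,c_0,c_1)$ means: for all $(s_0,s_1)\in P$, $s_0\in\mathrm{EvN}_{\to}\big(c_0(s_0),\{s_0'\mid s_1\in\mathrm{EvN}_{\to}(c_1(s_1),\{s_1'\mid (s_0',s_1')\in Q\wedge((s_0,s_1),(s_0',s_1'))\in F\})\}\big)$. -}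

module Defs where

open import Data.Nat using (ℕ; zero; suc; _<_)
open import Data.Product using (_×_; ∃; _,_)
open import Relation.Binary.PropositionalEquality using (_≡_)
open import Function.Bundles using (_⇔_)

Pred : Set → Set₁
Pred A = A → Set

Rel : Set → Set₁
Rel S = S → S → Set

_^[_] : {S : Set} → Rel S → ℕ → Rel S
(R ^[ zero ]) s t = s ≡ t
(R ^[ suc n ]) s t = ∃ λ u → R s u × (R ^[ n ]) u t

EvN : {S : Set} → Rel S → ℕ → Pred S → Pred S
EvN {S} R n Q s =
  ((s' : S) → (R ^[ n ]) s s' → Q s') ×
  ((s' : S) (l : ℕ) → l < n → (R ^[ l ]) s s' → ∃ λ s'' → R s' s'')

Ensures2 : {S : Set} → Rel S → Pred (S × S) → Pred (S × S) →
           Pred ((S × S) × (S × S)) → (S → ℕ) → (S → ℕ) → Set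
Ensures2 {S} R P Q F c₀ c₁ =
  (s₀ s₁ : S) → P (s₀ , s₁) →
  EvN R (c₀ s₀)
    (λ s₀' → EvN R (c₁ s₁)
       (λ s₁' → Q (s₀' , s₁') × F ((s₀ , s₁) , (s₀' , s₁')))
       s₁)
    s₀

_∩_ : {A : Set} → Pred A → Pred A → Pred A
(P ∩ Q) a = P a × Q a

{-# OPTIONS --safe #-}
module Submission where

open import Defs
open import Data.Nat using (ℕ)
open import Data.Product using (_×_; _,_; proj₁)
open import Function.Bundles using (_⇔_; Equivalence)

EvN-mono : {S : Set} (R : Rel S) (n : ℕ) {Q Q′ : Pred S} →
           (∀ s → Q s → Q′ s) → ∀ s → EvN R n Q s → EvN R n Q′ s
EvN-mono R n Q⊆Q′ s (reach , progress) =
  (λ s′ s→s′ → Q⊆Q′ s′ (reach s′ s→s′)) , progress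

Ensures2-consequence : {S : Set} (R : Rel S) {P P′ Q Q′ : Pred (S × S)}
  (F : Pred ((S × S) × (S × S))) (c₀ c₁ : S → ℕ) →
  (∀ σ → P′ σ → P σ) →
  (∀ σ σ′ → P′ σ → F (σ , σ′) → Q σ′ → Q′ σ′) →
  Ensures2 R P Q F c₀ c₁ → Ensures2 R P′ Q′ F c₀ c₁
Ensures2-consequence R F c₀ c₁ P′⊆P post E s₀ s₁ p′ =
  EvN-mono R (c₀ s₀)
    (λ s₀′ → EvN-mono R (c₁ s₁)
      (λ s₁′ (q , step) → post (s₀ , s₁) (s₀′ , s₁′) p′ step q , step) s₁)
    s₀ (E s₀ s₁ (P′⊆P (s₀ , s₁) p′))

mainTheorem11 : {S : Set} (R : Rel S) (P Q f : Pred (S × S))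
    (F : Pred ((S × S) × (S × S))) (c₀ c₁ : S → ℕ) →
    Ensures2 R P Q F c₀ c₁ →
    ((s₀ s₁ s₀' s₁' : S) → F ((s₀ , s₁) , (s₀' , s₁')) →
    (f (s₀ , s₁) ⇔ f (s₀' , s₁'))) →
    Ensures2 R (P ∩ f) (Q ∩ f) F c₀ c₁
mainTheorem11 R P Q f F c₀ c₁ E f-invariant =
  Ensures2-consequence R F c₀ c₁ (λ _ → proj₁) f-preserved E
  where
  f-preserved : ∀ σ σ′ → (P ∩ f) σ → F (σ , σ′) → Q σ′ → (Q ∩ f) σ′
  f-preserved (s₀ , s₁) (s₀′ , s₁′) (_ , fσ) step q =
    q , Equivalence.to (f-invariant s₀ s₁ s₀′ s₁′ step) fσ
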